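{- For every pair of integers $n>f\ge 1$, there exists an $n$-vertex graph $G^*=(V,E)$ such that every $f$-EFD connectivity certificate $H$ of $G^*$ has $\Omega(fn\log(n/f))$ edges.
   Context: For a graph $G=(V,E)$ and a set of edges $F\subseteq E$, let $\deg_F(x)$ be the number of edges of $F$ incident to vertex $x$. A subgraph $H\subseteq G$ (on the same vertex set) is an $f$-EFD (edge-faulty-degree) connectivity certificate of $G$ if for every $F\subseteq E$ with $\deg_F(x)\le f$ for all vertices $x$, and every two vertices $u,v$, the vertices $u$ and $v$ are connected in $H-F$ if and only if they are connected in $G-F$. $\log$ is base $2$. -}

module Defs where

open import Data.Nat using (ℕ; zero; suc; _+_; _<_; _<ᵇ_)
open import Data.Fin using (Fin; toℕ)
open import Data.Bool using (Bool; true; false; _∧_; not; if_then_else_)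
open import Data.Product using (_×_)
open import Relation.Binary.PropositionalEquality using (_≡_)
open import Relation.Binary.Construct.Closure.ReflexiveTransitive using (Star)
open import Function.Bundles using (_⇔_)

EdgeRel : ℕ → Set
EdgeRel n = Fin n → Fin n → Bool

IsGraph : ∀ {n} → EdgeRel n → Set
IsGraph {n} A = (∀ (i j : Fin n) → A i j ≡ A j i) × (∀ (i : Fin n) → A i i ≡ false)

IsSymmetric : ∀ {n} → EdgeRel n → Set
IsSymmetric {n} A = ∀ (i j : Fin n) → A i j ≡ A j i

_⊆ᴱ_ : ∀ {n} → EdgeRel n → EdgeRel n → Set
_⊆ᴱ_ {n} A B = ∀ (i j : Fin n) → A i j ≡ true → B i j ≡ true

_─_ : ∀ {n} → EdgeRel n → EdgeRel n → EdgeRel n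
(A ─ F) i j = A i j ∧ not (F i j)

countTrue : ∀ {m} → (Fin m → Bool) → ℕ
countTrue {zero} p = 0
countTrue {suc m} p = (if p Fin.zero then 1 else 0) + countTrue (λ i → p (Fin.suc i))

deg : ∀ {n} → EdgeRel n → Fin n → ℕ
deg F x = countTrue (F x)

edgeCount : ∀ {n} → EdgeRel n → ℕ
edgeCount {n} A = sumF (λ i → countTrue (λ j → (toℕ i <ᵇ toℕ j) ∧ A i j))
  where
  sumF : ∀ {m} → (Fin m → ℕ) → ℕ
  sumF {zero} g = 0
  sumF {suc m} g = g Fin.zero + sumF (λ i → g (Fin.suc i))

Connected : ∀ {n} → EdgeRel n → Fin n → Fin n → Set
Connected A u v = Star (λ x y → A x y ≡ true) u v

IsEFDCert : ∀ {n} → ℕ → EdgeRel n → EdgeRel n → Set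
IsEFDCert {n} f G H =
  H ⊆ᴱ G ×
  (∀ (F : EdgeRel n) → IsSymmetric F → F ⊆ᴱ G → (∀ x → deg F x Data.Nat.≤ f) →
     ∀ (u v : Fin n) → Connected (H ─ F) u v ⇔ Connected (G ─ F) u v)

{-# OPTIONS --safe #-}
-- Let S be a 2-colouring of the vertices such that every vertex has at most f edges of G
-- crossing S. A certificate H must contain every crossing edge uv: deleting the edges of H
-- that cross S is an admissible fault set F, uv survives in G − F, but H − F has no edge
-- across S, so it separates u from v.
--
-- Take G to be a blown-up k-cube padded with isolated vertices: each cube vertex becomes a
-- block of s ≤ f independent vertices and each cube edge a complete bipartite graph between
-- two blocks. Each of the k coordinate cuts meets every vertex in at most s edges and every
-- edge crosses one of them, so H ⊇ G, and by the handshake lemma 2 |H| ≥ 2^k s · k s.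
-- Choosing s = f and 2^k f ≤ n < 2^(k+1) f (or s = ⌊n/2⌋, k = 1 when n < 2f) gives
-- (n/f)^(fn) ≤ 2^(16 |H|).
module Submission where

open import Defs
open import Data.Nat
  using (ℕ; zero; suc; _+_; _*_; _^_; _∸_; _≤_; _<_; _<?_; z≤n; s≤s; ⌊_/2⌋; ⌈_/2⌉; >-nonZero)
open import Data.Nat.Properties
open import Data.Fin using (Fin; zero; suc; _↑ˡ_; _↑ʳ_; splitAt)
open import Data.Fin.Properties using (splitAt⁻¹-↑ˡ; splitAt⁻¹-↑ʳ)
open import Data.Sum using (inj₁; inj₂)
open import Data.Bool using (Bool; true; false; _∧_; not; _xor_; if_then_else_)
open import Data.Bool.Properties using (xor-comm; xor-same)
open import Data.Empty using (⊥-elim)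
open import Relation.Nullary using (yes; no)
open import Data.Product using (Σ; _×_; _,_; proj₁)
open import Data.Vec.Functional using (_++_; replicate)
open import Data.Vec.Functional.Properties using (lookup-++ˡ; lookup-++ʳ)
open import Function.Base using (_∘_; const)
open import Function.Bundles using (Equivalence)
open import Relation.Binary.PropositionalEquality
open import Relation.Binary.Construct.Closure.ReflexiveTransitive using (fold; ε; _◅_)
open import Algebra.Properties.CommutativeMonoid.Sum +-0-commutativeMonoid
  using (sum; sum-cong-≗; ∑-distrib-+)
open import Data.Nat.Tactic.RingSolver using (solve-∀)

-- Counting over Fin

sum-split : ∀ a {b} (w : Fin (a + b) → ℕ) →
            sum w ≡ sum (w ∘ (_↑ˡ b)) + sum (w ∘ (a ↑ʳ_))
sum-split zero    w = refl
sum-split (suc a) w = trans (cong (w zero +_) (sum-split a (w ∘ suc))) (sym (+-assoc (w zero) _ _))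

sum-mono-≤ : ∀ {n} {u v : Fin n → ℕ} → (∀ i → u i ≤ v i) → sum u ≤ sum v
sum-mono-≤ {zero}  u≤v = z≤n
sum-mono-≤ {suc n} u≤v = +-mono-≤ (u≤v zero) (sum-mono-≤ (u≤v ∘ suc))

sum-const : ∀ n c → sum {n} (const c) ≡ n * c
sum-const zero    c = refl
sum-const (suc n) c = cong (c +_) (sum-const n c)

countTrue≡sum : ∀ {n} (p : Fin n → Bool) → countTrue p ≡ sum (λ i → if p i then 1 else 0)
countTrue≡sum {zero}  p = refl
countTrue≡sum {suc n} p = cong ((if p zero then 1 else 0) +_) (countTrue≡sum (p ∘ suc))

countTrue-cong : ∀ {n} {p q : Fin n → Bool} → (∀ i → p i ≡ q i) → countTrue p ≡ countTrue q
countTrue-cong {zero}  p≗q = refl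
countTrue-cong {suc n} p≗q =
  cong₂ (λ b m → (if b then 1 else 0) + m) (p≗q zero) (countTrue-cong (p≗q ∘ suc))

countTrue-mono : ∀ {n} {p q : Fin n → Bool} → (∀ i → p i ≡ true → q i ≡ true) →
                 countTrue p ≤ countTrue q
countTrue-mono {n} {p} {q} p⇒q = begin
  countTrue p                        ≡⟨ countTrue≡sum p ⟩
  sum (λ i → if p i then 1 else 0)   ≤⟨ sum-mono-≤ (λ i → indicator-mono (p i) (q i) (p⇒q i)) ⟩
  sum (λ i → if q i then 1 else 0)   ≡⟨ countTrue≡sum q ⟨
  countTrue q                        ∎
  where
  open ≤-Reasoning
  indicator-mono : ∀ a b → (a ≡ true → b ≡ true) → (if a then 1 else 0) ≤ (if b then 1 else 0)
  indicator-mono true  b a⇒b rewrite a⇒b refl = ≤-refl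
  indicator-mono false b _ = z≤n

countTrue-split : ∀ a {b} (p : Fin (a + b) → Bool) →
                  countTrue p ≡ countTrue (p ∘ (_↑ˡ b)) + countTrue (p ∘ (a ↑ʳ_))
countTrue-split zero    p = refl
countTrue-split (suc a) p = trans (cong ((if p zero then 1 else 0) +_) (countTrue-split a (p ∘ suc)))
                                  (sym (+-assoc (if p zero then 1 else 0) _ _))

countTrue-++ : ∀ {a b} (u : Fin a → Bool) (v : Fin b → Bool) →
               countTrue (u ++ v) ≡ countTrue u + countTrue v
countTrue-++ {a} u v = trans (countTrue-split a (u ++ v))
  (cong₂ _+_ (countTrue-cong (lookup-++ˡ u v)) (countTrue-cong (lookup-++ʳ u v)))

countTrue-false : ∀ n → countTrue {n} (const false) ≡ 0
countTrue-false zero    = refl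
countTrue-false (suc n) = countTrue-false n

countTrue-true : ∀ n → countTrue {n} (const true) ≡ n
countTrue-true zero    = refl
countTrue-true (suc n) = cong suc (countTrue-true n)

handshake : ∀ {n} (A : EdgeRel n) → IsGraph A → sum (deg A) ≡ 2 * edgeCount A
handshake {zero}  A _ = refl
handshake {suc n} A (A-sym , A-irrefl) = begin
  deg A zero + sum (deg A ∘ suc)
    ≡⟨ cong₂ _+_ loop-free (∑-distrib-+ column (deg A′)) ⟩
  r + (sum column + sum (deg A′))
    ≡⟨ cong₂ (λ c d → r + (c + d)) column≡row (handshake A′ (A-sym′ , A-irrefl ∘ suc)) ⟩
  r + (r + 2 * edgeCount A′)
    ≡⟨ regroup r (edgeCount A′) ⟩
  2 * (r + edgeCount A′)
    ∎
  where
  open ≡-Reasoning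
  regroup : ∀ x y → x + (x + 2 * y) ≡ 2 * (x + y)
  regroup = solve-∀
  A′ : EdgeRel n
  A′ i j = A (suc i) (suc j)
  A-sym′ : ∀ i j → A′ i j ≡ A′ j i
  A-sym′ i j = A-sym (suc i) (suc j)
  r : ℕ
  r = countTrue (λ j → A zero (suc j))
  column : Fin n → ℕ
  column i = if A (suc i) zero then 1 else 0
  loop-free : deg A zero ≡ r
  loop-free = cong (λ b → (if b then 1 else 0) + r) (A-irrefl zero)
  column≡row : sum column ≡ r
  column≡row = trans (sym (countTrue≡sum (λ i → A (suc i) zero)))
                     (countTrue-cong (λ i → A-sym (suc i) zero))

-- Sparse cuts and certificates

∧-trueˡ : ∀ {a b} → a ∧ b ≡ true → a ≡ true
∧-trueˡ {true} _ = refl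

∧-monoˡ-true : ∀ {a b} c → (a ≡ true → b ≡ true) → a ∧ c ≡ true → b ∧ c ≡ true
∧-monoˡ-true {true} c a⇒b ac rewrite a⇒b refl = ac

cutEdges : ∀ {n} → EdgeRel n → (Fin n → Bool) → EdgeRel n
cutEdges G S x y = G x y ∧ (S x xor S y)

-- deg (cutEdges G S) x unfolds to crossingCount (G x) (S x) S.
crossingCount : ∀ {a} → (Fin a → Bool) → Bool → (Fin a → Bool) → ℕ
crossingCount row c S = countTrue (λ y → row y ∧ (c xor S y))

SparseCut : ∀ {n} → ℕ → EdgeRel n → (Fin n → Bool) → Set
SparseCut f G S = ∀ x → deg (cutEdges G S) x ≤ f

CoveredBySparseCuts : ∀ {n} → ℕ → EdgeRel n → Set
CoveredBySparseCuts {n} f G =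
  ∀ u v → G u v ≡ true → Σ (Fin n → Bool) λ S → SparseCut f G S × (S u xor S v) ≡ true

covered-mono : ∀ {n s f} {G : EdgeRel n} → s ≤ f → CoveredBySparseCuts s G → CoveredBySparseCuts f G
covered-mono s≤f covered x y xy with S , sparse , crosses ← covered x y xy =
  S , (λ z → ≤-trans (sparse z) s≤f) , crosses

off-cut-path-preserves-colour : ∀ {n} (H : EdgeRel n) (S : Fin n → Bool) {u v} →
                                Connected (H ─ cutEdges H S) u v → S u ≡ S v
off-cut-path-preserves-colour H S = fold (λ x y → S x ≡ S y) (λ e → trans (uncut (H _ _) (S _) (S _) e)) refl
  where
  uncut : ∀ h a b → h ∧ not (h ∧ (a xor b)) ≡ true → a ≡ b
  uncut true true  true  _ = refl
  uncut true false false _ = refl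
  uncut false _ _ ()
  uncut true true  false ()
  uncut true false true  ()

certificate-keeps-sparse-cut-edge : ∀ {n f} {G H : EdgeRel n} {S : Fin n → Bool} →
                                    IsSymmetric H → IsEFDCert f G H → SparseCut f G S →
                                    ∀ {u v} → G u v ≡ true → (S u xor S v) ≡ true → H u v ≡ true
certificate-keeps-sparse-cut-edge {f = f} {G} {H} {S} H-sym (H⊆G , certified) sparse {u} {v} Guv Suv
  with H u v in Huv
... | true  = refl
... | false = begin
  false                ≡⟨ xor-same (S u) ⟨
  S u xor S u          ≡⟨ cong (S u xor_) (off-cut-path-preserves-colour H S path-in-H) ⟩
  S u xor S v          ≡⟨ Suv ⟩
  true                 ∎
  where
  open ≡-Reasoning
  F : EdgeRel _
  F = cutEdges H S
  F-sym : IsSymmetric F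
  F-sym x y = cong₂ _∧_ (H-sym x y) (xor-comm (S x) (S y))
  F⊆G : F ⊆ᴱ G
  F⊆G x y Fxy = H⊆G x y (∧-trueˡ Fxy)
  F-deg : ∀ x → deg F x ≤ f
  F-deg x = ≤-trans (countTrue-mono (λ y → ∧-monoˡ-true _ (H⊆G x y))) (sparse x)
  uv-survives : (G ─ F) u v ≡ true
  uv-survives = cong₂ (λ g h → g ∧ not (h ∧ (S u xor S v))) Guv Huv
  path-in-H : Connected (H ─ F) u v
  path-in-H = Equivalence.from (certified F F-sym F⊆G F-deg u v) (uv-survives ◅ ε)

certificate-contains-covered : ∀ {n f} {G H : EdgeRel n} → IsSymmetric H → IsEFDCert f G H →
                               CoveredBySparseCuts f G → G ⊆ᴱ H
certificate-contains-covered H-sym cert covered u v Guv with S , sparse , Suv ← covered u v Guv =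
  certificate-keeps-sparse-cut-edge {S = S} H-sym cert sparse Guv Suv

certificate-size-bound : ∀ {n f} {G H : EdgeRel n} → IsGraph H → IsEFDCert f G H →
                         CoveredBySparseCuts f G → sum (deg G) ≤ 2 * edgeCount H
certificate-size-bound {G = G} {H} H-graph cert covered = begin
  sum (deg G)        ≤⟨ sum-mono-≤ (λ x → countTrue-mono (G⊆H x)) ⟩
  sum (deg H)        ≡⟨ handshake H H-graph ⟩
  2 * edgeCount H    ∎
  where
  open ≤-Reasoning
  G⊆H : G ⊆ᴱ H
  G⊆H = certificate-contains-covered (proj₁ H-graph) cert covered

-- Block adjacency matrices

data Half (a b : ℕ) : Fin (a + b) → Set where
  left  : (i : Fin a) → Half a b (i ↑ˡ b)
  right : (j : Fin b) → Half a b (a ↑ʳ j)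

half : ∀ a {b} (x : Fin (a + b)) → Half a b x
half a {b} x with splitAt a x in split≡
... | inj₁ i = subst (Half a b) (splitAt⁻¹-↑ˡ split≡) (left i)
... | inj₂ j = subst (Half a b) (splitAt⁻¹-↑ʳ split≡) (right j)

-- The adjacency matrix [[A, B], [C, D]]. It is opaque so that unification sees block and
-- not its unfolding through splitAt.
opaque
  block : ∀ {a b} → (Fin a → Fin a → Bool) → (Fin a → Fin b → Bool) →
          (Fin b → Fin a → Bool) → (Fin b → Fin b → Bool) → EdgeRel (a + b)
  block A B C D = (λ i → A i ++ B i) ++ (λ j → C j ++ D j)

  block-row-↑ˡ : ∀ {a b} A B C D (i : Fin a) → block {a} {b} A B C D (i ↑ˡ b) ≡ A i ++ B i
  block-row-↑ˡ A B C D = lookup-++ˡ (λ i → A i ++ B i) (λ j → C j ++ D j)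

  block-row-↑ʳ : ∀ {a b} A B C D (j : Fin b) → block {a} {b} A B C D (a ↑ʳ j) ≡ C j ++ D j
  block-row-↑ʳ A B C D = lookup-++ʳ (λ i → A i ++ B i) (λ j → C j ++ D j)

module _ {a b : ℕ} {A : Fin a → Fin a → Bool} {B : Fin a → Fin b → Bool}
         {C : Fin b → Fin a → Bool} {D : Fin b → Fin b → Bool} where

  block-↑ˡ-↑ˡ : ∀ i j → block A B C D (i ↑ˡ b) (j ↑ˡ b) ≡ A i j
  block-↑ˡ-↑ˡ i j = trans (cong-app (block-row-↑ˡ A B C D i) (j ↑ˡ b)) (lookup-++ˡ (A i) (B i) j)

  block-↑ˡ-↑ʳ : ∀ i j → block A B C D (i ↑ˡ b) (a ↑ʳ j) ≡ B i j
  block-↑ˡ-↑ʳ i j = trans (cong-app (block-row-↑ˡ A B C D i) (a ↑ʳ j)) (lookup-++ʳ (A i) (B i) j)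

  block-↑ʳ-↑ˡ : ∀ i j → block A B C D (a ↑ʳ i) (j ↑ˡ b) ≡ C i j
  block-↑ʳ-↑ˡ i j = trans (cong-app (block-row-↑ʳ A B C D i) (j ↑ˡ b)) (lookup-++ˡ (C i) (D i) j)

  block-↑ʳ-↑ʳ : ∀ i j → block A B C D (a ↑ʳ i) (a ↑ʳ j) ≡ D i j
  block-↑ʳ-↑ʳ i j = trans (cong-app (block-row-↑ʳ A B C D i) (a ↑ʳ j)) (lookup-++ʳ (C i) (D i) j)

  block-sym : IsSymmetric A → (∀ i j → B i j ≡ C j i) → IsSymmetric D → IsSymmetric (block A B C D)
  block-sym A-sym B≡Cᵀ D-sym x y with half a x | half a y
  ... | left i  | left j  = trans (block-↑ˡ-↑ˡ i j) (trans (A-sym i j) (sym (block-↑ˡ-↑ˡ j i)))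
  ... | left i  | right j = trans (block-↑ˡ-↑ʳ i j) (trans (B≡Cᵀ i j) (sym (block-↑ʳ-↑ˡ j i)))
  ... | right i | left j  = trans (block-↑ʳ-↑ˡ i j) (trans (sym (B≡Cᵀ j i)) (sym (block-↑ˡ-↑ʳ j i)))
  ... | right i | right j = trans (block-↑ʳ-↑ʳ i j) (trans (D-sym i j) (sym (block-↑ʳ-↑ʳ j i)))

  block-irrefl : (∀ i → A i i ≡ false) → (∀ j → D j j ≡ false) → ∀ x → block A B C D x x ≡ false
  block-irrefl A-irrefl D-irrefl x with half a x
  ... | left i  = trans (block-↑ˡ-↑ˡ i i) (A-irrefl i)
  ... | right j = trans (block-↑ʳ-↑ʳ j j) (D-irrefl j)

  deg-block-↑ˡ : ∀ i → deg (block A B C D) (i ↑ˡ b) ≡ countTrue (A i) + countTrue (B i)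
  deg-block-↑ˡ i = trans (cong countTrue (block-row-↑ˡ A B C D i)) (countTrue-++ (A i) (B i))

  deg-block-↑ʳ : ∀ j → deg (block A B C D) (a ↑ʳ j) ≡ countTrue (C j) + countTrue (D j)
  deg-block-↑ʳ j = trans (cong countTrue (block-row-↑ʳ A B C D j)) (countTrue-++ (C j) (D j))

crossingCount-++ : ∀ {a b} (u : Fin a → Bool) (v : Fin b → Bool) c S T →
                   crossingCount (u ++ v) c (S ++ T) ≡ crossingCount u c S + crossingCount v c T
crossingCount-++ {a} u v c S T = trans (countTrue-split a _) (cong₂ _+_
  (countTrue-cong (λ j → cong₂ (λ r t → r ∧ (c xor t)) (lookup-++ˡ u v j) (lookup-++ˡ S T j)))
  (countTrue-cong (λ j → cong₂ (λ r t → r ∧ (c xor t)) (lookup-++ʳ u v j) (lookup-++ʳ S T j))))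

crossingCount-≤ : ∀ {a} (row : Fin a → Bool) c S → crossingCount row c S ≤ countTrue row
crossingCount-≤ {a} row c S = countTrue-mono {a} (λ y → ∧-trueˡ)

crossingCount-≡0 : ∀ {a} (row : Fin a → Bool) c S → (∀ y → row y ≡ true → S y ≡ c) →
                   crossingCount row c S ≡ 0
crossingCount-≡0 {a} row c S row⇒c = trans (countTrue-cong no-crossing) (countTrue-false a)
  where
  no-crossing : ∀ y → row y ∧ (c xor S y) ≡ false
  no-crossing y with row y in row-y
  ... | false = refl
  ... | true  = trans (cong (c xor_) (row⇒c y row-y)) (xor-same c)

module _ {a b : ℕ} {A : Fin a → Fin a → Bool} {B : Fin a → Fin b → Bool}
         {C : Fin b → Fin a → Bool} {D : Fin b → Fin b → Bool}
         (S : Fin a → Bool) (T : Fin b → Bool) where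

  cut-degree-block-↑ˡ : ∀ i → deg (cutEdges (block A B C D) (S ++ T)) (i ↑ˡ b) ≡
                              crossingCount (A i) (S i) S + crossingCount (B i) (S i) T
  cut-degree-block-↑ˡ i =
    trans (cong₂ (λ row c → crossingCount row c (S ++ T)) (block-row-↑ˡ A B C D i) (lookup-++ˡ S T i))
          (crossingCount-++ (A i) (B i) (S i) S T)

  cut-degree-block-↑ʳ : ∀ j → deg (cutEdges (block A B C D) (S ++ T)) (a ↑ʳ j) ≡
                              crossingCount (C j) (T j) S + crossingCount (D j) (T j) T
  cut-degree-block-↑ʳ j =
    trans (cong₂ (λ row c → crossingCount row c (S ++ T)) (block-row-↑ʳ A B C D j) (lookup-++ʳ S T j))
          (crossingCount-++ (C j) (D j) (T j) S T)

none : ∀ {a b} → Fin a → Fin b → Bool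
none _ _ = false

diagonal-block-respects : ∀ {a b} {A : Fin a → Fin a → Bool} {D : Fin b → Fin b → Bool}
                          {S : Fin a → Bool} {T : Fin b → Bool} →
                          (∀ i j → A i j ≡ true → S i ≡ S j) → (∀ i j → D i j ≡ true → T i ≡ T j) →
                          ∀ x y → block A none none D x y ≡ true → (S ++ T) x ≡ (S ++ T) y
diagonal-block-respects {a} {b} {A} {D} {S} {T} A⇒S D⇒T x y xy with half a x | half a y
... | left i  | left j  = begin
  (S ++ T) (i ↑ˡ b)  ≡⟨ lookup-++ˡ S T i ⟩
  S i                ≡⟨ A⇒S i j (trans (sym (block-↑ˡ-↑ˡ i j)) xy) ⟩
  S j                ≡⟨ lookup-++ˡ S T j ⟨
  (S ++ T) (j ↑ˡ b)  ∎
  where open ≡-Reasoning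
... | left i  | right j with () ← trans (sym (block-↑ˡ-↑ʳ {A = A} {D = D} i j)) xy
... | right i | left j  with () ← trans (sym (block-↑ʳ-↑ˡ {A = A} {D = D} i j)) xy
... | right i | right j = begin
  (S ++ T) (a ↑ʳ i)  ≡⟨ lookup-++ʳ S T i ⟩
  T i                ≡⟨ D⇒T i j (trans (sym (block-↑ʳ-↑ʳ i j)) xy) ⟩
  T j                ≡⟨ lookup-++ʳ S T j ⟨
  (S ++ T) (a ↑ʳ j)  ∎
  where open ≡-Reasoning

zero+≤ : ∀ {x y z} → x ≡ 0 → y ≤ z → x + y ≤ z
zero+≤ refl y≤z = y≤z

≤+zero : ∀ {x y z} → x ≤ z → y ≡ 0 → x + y ≤ z
≤+zero {x} {z = z} x≤z refl = subst (_≤ z) (sym (+-identityʳ x)) x≤z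

pad : ∀ {a} r → EdgeRel a → EdgeRel (a + r)
pad r A = block A none none none

module _ {a r : ℕ} {A : EdgeRel a} where

  pad-isGraph : IsGraph A → IsGraph (pad r A)
  pad-isGraph (A-sym , A-irrefl) =
    block-sym A-sym (λ _ _ → refl) (λ _ _ → refl) , block-irrefl A-irrefl (λ _ → refl)

  pad-degree-sum : sum (deg (pad r A)) ≡ sum (deg A)
  pad-degree-sum = begin
    sum (deg (pad r A))
      ≡⟨ sum-split a (deg (pad r A)) ⟩
    sum (deg (pad r A) ∘ (_↑ˡ r)) + sum (deg (pad r A) ∘ (a ↑ʳ_))
      ≡⟨ cong₂ _+_ (sum-cong-≗ old-rows) (sum-cong-≗ new-rows) ⟩
    sum (deg A) + sum {r} (const 0)
      ≡⟨ cong (sum (deg A) +_) (trans (sum-const r 0) (*-zeroʳ r)) ⟩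
    sum (deg A) + 0
      ≡⟨ +-identityʳ _ ⟩
    sum (deg A)
      ∎
    where
    open ≡-Reasoning
    old-rows : ∀ i → deg (pad r A) (i ↑ˡ r) ≡ deg A i
    old-rows i = trans (deg-block-↑ˡ i) (trans (cong (deg A i +_) (countTrue-false r)) (+-identityʳ _))
    new-rows : ∀ j → deg (pad r A) (a ↑ʳ j) ≡ 0
    new-rows j = trans (deg-block-↑ʳ {A = A} j) (cong₂ _+_ (countTrue-false a) (countTrue-false r))

  pad-covered : ∀ {f} → CoveredBySparseCuts f A → CoveredBySparseCuts f (pad r A)
  pad-covered {f} covered x y xy with half a x | half a y
  ... | left i  | left j  with S , sparse , crosses ← covered i j (trans (sym (block-↑ˡ-↑ˡ i j)) xy) =
    S ++ falses , padded-sparse , trans (cong₂ _xor_ (lookup-++ˡ S falses i) (lookup-++ˡ S falses j)) crosses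
    where
    falses = replicate r false
    padded-sparse : SparseCut f (pad r A) (S ++ falses)
    padded-sparse x with half a x
    ... | left i  = ≤-trans (≤-reflexive (cut-degree-block-↑ˡ S falses i))
                      (≤+zero (sparse i) (crossingCount-≡0 (none i) (S i) falses λ _ ()))
    ... | right j = ≤-trans (≤-reflexive (cut-degree-block-↑ʳ S falses j))
                      (zero+≤ (crossingCount-≡0 (none j) false S λ _ ())
                              (≤-trans (≤-reflexive (crossingCount-≡0 (none j) false falses λ _ ())) z≤n))
  ... | left i  | right j with () ← trans (sym (block-↑ˡ-↑ʳ {A = A} {D = none} i j)) xy
  ... | right i | left j  with () ← trans (sym (block-↑ʳ-↑ˡ {A = A} {D = none} i j)) xy
  ... | right i | right j with () ← trans (sym (block-↑ʳ-↑ʳ {A = A} {D = none} i j)) xy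

twin : ∀ {a} → (Fin a → Fin a → Bool) → (Fin a → Fin a → Bool) → EdgeRel (a + a)
twin D O = block D O O D

-- side k t x is coordinate t of the cube vertex whose block contains x, coordinate zero
-- being the one added by the last doubling.
module BlownUpCube (s : ℕ) where

  order : ℕ → ℕ
  order zero    = s
  order (suc k) = order k + order k

  sameBlock : ∀ k → EdgeRel (order k)
  sameBlock zero    _ _ = true
  sameBlock (suc k)     = twin (sameBlock k) none

  cube : ∀ k → EdgeRel (order k)
  cube zero    = none
  cube (suc k) = twin (cube k) (sameBlock k)

  side : ∀ k → Fin k → Fin (order k) → Bool
  side (suc k) zero    = replicate (order k) true ++ replicate (order k) false
  side (suc k) (suc t) = side k t ++ side k t

  sameBlock-sym : ∀ k → IsSymmetric (sameBlock k)
  sameBlock-sym zero    _ _ = refl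
  sameBlock-sym (suc k)     = block-sym (sameBlock-sym k) (λ _ _ → refl) (sameBlock-sym k)

  sameBlock-degree : ∀ k x → deg (sameBlock k) x ≡ s
  sameBlock-degree zero    x = countTrue-true s
  sameBlock-degree (suc k) x with half (order k) x
  ... | left i  = trans (deg-block-↑ˡ i)
                    (trans (cong₂ _+_ (sameBlock-degree k i) (countTrue-false (order k))) (+-identityʳ s))
  ... | right j = trans (deg-block-↑ʳ {A = sameBlock k} j)
                    (cong₂ _+_ (countTrue-false (order k)) (sameBlock-degree k j))

  sameBlock-crossingCount-≤ : ∀ k i c S → crossingCount (sameBlock k i) c S ≤ s
  sameBlock-crossingCount-≤ k i c S =
    ≤-trans (crossingCount-≤ (sameBlock k i) c S) (≤-reflexive (sameBlock-degree k i))

  sameBlock-side : ∀ k t x y → sameBlock k x y ≡ true → side k t x ≡ side k t y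
  sameBlock-side (suc k) zero    = diagonal-block-respects (λ _ _ _ → refl) (λ _ _ _ → refl)
  sameBlock-side (suc k) (suc t) = diagonal-block-respects (sameBlock-side k t) (sameBlock-side k t)

  cube-isGraph : ∀ k → IsGraph (cube k)
  cube-isGraph zero    = (λ _ _ → refl) , (λ _ → refl)
  cube-isGraph (suc k) with cube-sym , cube-irrefl ← cube-isGraph k =
    block-sym cube-sym (sameBlock-sym k) cube-sym , block-irrefl cube-irrefl cube-irrefl

  cube-degree : ∀ k x → deg (cube k) x ≡ k * s
  cube-degree zero    x = countTrue-false s
  cube-degree (suc k) x with half (order k) x
  ... | left i  = trans (deg-block-↑ˡ i)
                    (trans (cong₂ _+_ (cube-degree k i) (sameBlock-degree k i)) (+-comm (k * s) s))
  ... | right j = trans (deg-block-↑ʳ {A = cube k} j) (cong₂ _+_ (sameBlock-degree k j) (cube-degree k j))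

  side-↑ˡ : ∀ k t i → side (suc k) (suc t) (i ↑ˡ order k) ≡ side k t i
  side-↑ˡ k t = lookup-++ˡ (side k t) (side k t)

  side-↑ʳ : ∀ k t j → side (suc k) (suc t) (order k ↑ʳ j) ≡ side k t j
  side-↑ʳ k t = lookup-++ʳ (side k t) (side k t)

  top-side-↑ˡ : ∀ k i → side (suc k) zero (i ↑ˡ order k) ≡ true
  top-side-↑ˡ k = lookup-++ˡ (replicate (order k) true) (replicate (order k) false)

  top-side-↑ʳ : ∀ k j → side (suc k) zero (order k ↑ʳ j) ≡ false
  top-side-↑ʳ k = lookup-++ʳ (replicate (order k) true) (replicate (order k) false)

  cube-edge-crosses-side : ∀ k x y → cube k x y ≡ true →
                           Σ (Fin k) λ t → (side k t x xor side k t y) ≡ true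
  cube-edge-crosses-side (suc k) x y xy with half (order k) x | half (order k) y
  ... | left i  | left j  with t , crosses ← cube-edge-crosses-side k i j (trans (sym (block-↑ˡ-↑ˡ i j)) xy) =
    suc t , trans (cong₂ _xor_ (side-↑ˡ k t i) (side-↑ˡ k t j)) crosses
  ... | left i  | right j = zero , cong₂ _xor_ (top-side-↑ˡ k i) (top-side-↑ʳ k j)
  ... | right i | left j  = zero , cong₂ _xor_ (top-side-↑ʳ k i) (top-side-↑ˡ k j)
  ... | right i | right j with t , crosses ← cube-edge-crosses-side k i j (trans (sym (block-↑ʳ-↑ʳ i j)) xy) =
    suc t , trans (cong₂ _xor_ (side-↑ʳ k t i) (side-↑ʳ k t j)) crosses

  side-sparse : ∀ k t → SparseCut s (cube k) (side k t)
  side-sparse (suc k) zero x with half (order k) x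
  ... | left i  = ≤-trans (≤-reflexive (cut-degree-block-↑ˡ trues falses i))
                    (zero+≤ (crossingCount-≡0 (cube k i) true trues λ _ _ → refl)
                            (sameBlock-crossingCount-≤ k i true falses))
    where trues = replicate (order k) true ; falses = replicate (order k) false
  ... | right j = ≤-trans (≤-reflexive (cut-degree-block-↑ʳ trues falses j))
                    (≤+zero (sameBlock-crossingCount-≤ k j false trues)
                            (crossingCount-≡0 (cube k j) false falses λ _ _ → refl))
    where trues = replicate (order k) true ; falses = replicate (order k) false
  side-sparse (suc k) (suc t) x with half (order k) x
  ... | left i  = ≤-trans (≤-reflexive (cut-degree-block-↑ˡ (side k t) (side k t) i))
                    (≤+zero (side-sparse k t i)
                            (crossingCount-≡0 (sameBlock k i) _ _ λ y e → sym (sameBlock-side k t i y e)))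
  ... | right j = ≤-trans (≤-reflexive (cut-degree-block-↑ʳ (side k t) (side k t) j))
                    (zero+≤ (crossingCount-≡0 (sameBlock k j) _ _ λ y e → sym (sameBlock-side k t j y e))
                            (side-sparse k t j))

  cube-covered : ∀ k → CoveredBySparseCuts s (cube k)
  cube-covered k x y xy with t , crosses ← cube-edge-crosses-side k x y xy =
    side k t , side-sparse k t , crosses

  order≡2^k*s : ∀ k → order k ≡ 2 ^ k * s
  order≡2^k*s zero    = sym (*-identityˡ s)
  order≡2^k*s (suc k) = begin
    order k + order k          ≡⟨ cong₂ _+_ (order≡2^k*s k) (order≡2^k*s k) ⟩
    2 ^ k * s + 2 ^ k * s      ≡⟨ cong (2 ^ k * s +_) (+-identityʳ (2 ^ k * s)) ⟨
    2 * (2 ^ k * s)            ≡⟨ *-assoc 2 (2 ^ k) s ⟨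
    2 ^ suc k * s              ∎
    where open ≡-Reasoning

  cube-degree-sum : ∀ k → sum (deg (cube k)) ≡ order k * (k * s)
  cube-degree-sum k = trans (sum-cong-≗ (cube-degree k)) (sum-const (order k) (k * s))

  padded-cube : ∀ k {N} → 2 ^ k * s ≤ N →
                Σ (EdgeRel N) λ G → IsGraph G × CoveredBySparseCuts s G × sum (deg G) ≡ 2 ^ k * s * (k * s)
  padded-cube k {N} fits with N ∸ order k | m+[n∸m]≡n (subst (_≤ N) (sym (order≡2^k*s k)) fits)
  ... | r | refl = pad r (cube k) , pad-isGraph (cube-isGraph k) , pad-covered (cube-covered k) ,
                   trans (pad-degree-sum {A = cube k})
                         (trans (cube-degree-sum k) (cong (_* (k * s)) (order≡2^k*s k)))

-- Choice of parameters

^-distribʳ-* : ∀ a b e → (a * b) ^ e ≡ a ^ e * b ^ e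
^-distribʳ-* a b zero    = refl
^-distribʳ-* a b (suc e) = trans (cong (a * b *_) (^-distribʳ-* a b e)) (interchange a b (a ^ e) (b ^ e))
  where
  interchange : ∀ a b x y → a * b * (x * y) ≡ a * x * (b * y)
  interchange = solve-∀

power-bound : ∀ {n f c D} e → n ≤ 2 ^ c * f → c * e ≤ D → n ^ e ≤ 2 ^ D * f ^ e
power-bound {n} {f} {c} {D} e n≤2^cf ce≤D = begin
  n ^ e                ≤⟨ ^-monoˡ-≤ e n≤2^cf ⟩
  (2 ^ c * f) ^ e      ≡⟨ ^-distribʳ-* (2 ^ c) f e ⟩
  (2 ^ c) ^ e * f ^ e  ≡⟨ cong (_* f ^ e) (^-*-assoc 2 c e) ⟩
  2 ^ (c * e) * f ^ e  ≤⟨ *-monoˡ-≤ (f ^ e) (^-monoʳ-≤ 2 ce≤D) ⟩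
  2 ^ D * f ^ e        ∎
  where open ≤-Reasoning

n<2^n : ∀ n → n < 2 ^ n
n<2^n zero    = s≤s z≤n
n<2^n (suc n) = ≤-<-trans (n<2^n n) (m<m+n (2 ^ n) (≤-trans (m^n>0 2 n) (m≤m+n (2 ^ n) 0)))

dyadic-bracket : ∀ {f n} k → f ≤ n → n < 2 ^ k * f → Σ ℕ λ j → 2 ^ j * f ≤ n × n < 2 ^ suc j * f
dyadic-bracket {f} {n} zero f≤n n<f = ⊥-elim (<⇒≱ n<f (subst (_≤ n) (sym (*-identityˡ f)) f≤n))
dyadic-bracket {f} {n} (suc k) f≤n n<2^[1+k]f with n <? 2 ^ k * f
... | yes n<2^kf = dyadic-bracket k f≤n n<2^kf
... | no  n≮2^kf = k , ≮⇒≥ n≮2^kf , n<2^[1+k]f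

record CubeParameters (n f : ℕ) : Set where
  field
    s k c            : ℕ
    s≤f              : s ≤ f
    cube-fits        : 2 ^ k * s ≤ n
    n≤2^c*f          : n ≤ 2 ^ c * f
    c*fn≤8*degree-sum : c * (f * n) ≤ 8 * (2 ^ k * s * (k * s))

few-vertices-parameters : ∀ {n f} → 1 ≤ f → f < n → n < f + f → CubeParameters n f
few-vertices-parameters {n} {f} 1≤f f<n n<2f = record
  { s = h ; k = 1 ; c = 1
  ; s≤f = <⇒≤ h<f
  ; cube-fits = subst (_≤ n) (cong (h +_) (sym (+-identityʳ h))) h+h≤n
  ; n≤2^c*f = subst (n ≤_) (cong (f +_) (sym (+-identityʳ f))) (<⇒≤ n<2f)
  ; c*fn≤8*degree-sum = begin
      1 * (f * n)                    ≡⟨ *-identityˡ (f * n) ⟩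
      f * n                          ≤⟨ *-monoˡ-≤ n (<⇒≤ f<n) ⟩
      n * n                          ≤⟨ *-mono-≤ n≤3h n≤3h ⟩
      (h + (h + h)) * (h + (h + h))  ≡⟨ [3h]²≡9h² h ⟩
      9 * (h * h)                    ≤⟨ *-monoˡ-≤ (h * h) (m≤m+n 9 7) ⟩
      16 * (h * h)                   ≡⟨ 16h²≡degree-sum h ⟩
      8 * (2 ^ 1 * h * (1 * h))      ∎
  }
  where
  open ≤-Reasoning
  h : ℕ
  h = ⌊ n /2⌋
  h+h≤n : h + h ≤ n
  h+h≤n = ≤-trans (+-monoʳ-≤ h (⌊n/2⌋≤⌈n/2⌉ n)) (≤-reflexive (⌊n/2⌋+⌈n/2⌉≡n n))
  h<f : h < f
  h<f = ≰⇒> λ f≤h → <⇒≱ (≤-<-trans h+h≤n n<2f) (+-mono-≤ f≤h f≤h)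
  1≤h : 1 ≤ h
  1≤h = ⌊n/2⌋-mono (≤-trans (s≤s 1≤f) f<n)
  n≤3h : n ≤ h + (h + h)
  n≤3h = begin
    n              ≡⟨ ⌊n/2⌋+⌈n/2⌉≡n n ⟨
    h + ⌈ n /2⌉    ≤⟨ +-monoʳ-≤ h (⌊n/2⌋-mono (n≤1+n (suc n))) ⟩
    h + suc h      ≤⟨ +-monoʳ-≤ h (+-monoˡ-≤ h 1≤h) ⟩
    h + (h + h)    ∎
  [3h]²≡9h² : ∀ h → (h + (h + h)) * (h + (h + h)) ≡ 9 * (h * h)
  [3h]²≡9h² = solve-∀
  16h²≡degree-sum : ∀ h → 16 * (h * h) ≡ 8 * (2 ^ 1 * h * (1 * h))
  16h²≡degree-sum = solve-∀

many-vertices-parameters : ∀ {n f} → 1 ≤ f → f + f ≤ n → CubeParameters n f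
many-vertices-parameters {n} {f} 1≤f 2f≤n
  with dyadic-bracket n (≤-trans (m≤m+n f f) 2f≤n) (≤-trans (n<2^n n) (m≤m*n (2 ^ n) f {{>-nonZero 1≤f}}))
... | zero  , _    , n<2f = ⊥-elim (<⇒≱ n<2f (subst (_≤ n) (cong (f +_) (sym (+-identityʳ f))) 2f≤n))
... | suc j , fits , n<2M = record
  { s = f ; k = k ; c = suc k
  ; s≤f = ≤-refl
  ; cube-fits = fits
  ; n≤2^c*f = <⇒≤ n<2M
  ; c*fn≤8*degree-sum = begin
      suc k * (f * n)          ≤⟨ *-monoˡ-≤ (f * n) (+-monoˡ-≤ k {1} {k} (s≤s z≤n)) ⟩
      (k + k) * (f * n)        ≤⟨ *-monoʳ-≤ (k + k) (*-monoʳ-≤ f n≤2M) ⟩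
      (k + k) * (f * (2 * M))  ≡⟨ regroup k f M ⟩
      4 * (M * (k * f))        ≤⟨ *-monoˡ-≤ (M * (k * f)) (m≤m+n 4 4) ⟩
      8 * (M * (k * f))        ∎
  }
  where
  open ≤-Reasoning
  k : ℕ
  k = suc j
  M : ℕ
  M = 2 ^ k * f
  n≤2M : n ≤ 2 * M
  n≤2M = ≤-trans (<⇒≤ n<2M) (≤-reflexive (*-assoc 2 (2 ^ k) f))
  regroup : ∀ k f M → (k + k) * (f * (2 * M)) ≡ 4 * (M * (k * f))
  regroup = solve-∀

cube-parameters : ∀ {n f} → 1 ≤ f → f < n → CubeParameters n f
cube-parameters {n} {f} 1≤f f<n with n <? f + f
... | yes n<2f = few-vertices-parameters 1≤f f<n n<2f
... | no  n≮2f = many-vertices-parameters 1≤f (≮⇒≥ n≮2f)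

mainTheorem2 : Σ ℕ (λ d → 1 ≤ d ×
    ((n f : ℕ) → 1 ≤ f → f < n →
    Σ (EdgeRel n) (λ G → IsGraph G ×
    ((H : EdgeRel n) → IsGraph H → IsEFDCert f G H →
    n ^ (f * n) ≤ 2 ^ (d * edgeCount H) * f ^ (f * n)))))
mainTheorem2 = 16 , s≤s z≤n , λ n f 1≤f f<n → lower-bound-graph (cube-parameters 1≤f f<n)
  where
  lower-bound-graph : ∀ {n f} → CubeParameters n f →
    Σ (EdgeRel n) λ G → IsGraph G × ((H : EdgeRel n) → IsGraph H → IsEFDCert f G H →
      n ^ (f * n) ≤ 2 ^ (16 * edgeCount H) * f ^ (f * n))
  lower-bound-graph {n} {f} P =
    let (G , G-graph , G-covered , G-degrees) = BlownUpCube.padded-cube s k cube-fits in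
    G , G-graph , λ H H-graph cert → power-bound {c = c} (f * n) n≤2^c*f (begin
      c * (f * n)                ≤⟨ c*fn≤8*degree-sum ⟩
      8 * (2 ^ k * s * (k * s))  ≡⟨ cong (8 *_) G-degrees ⟨
      8 * sum (deg G)            ≤⟨ *-monoʳ-≤ 8 (certificate-size-bound H-graph cert
                                                   (covered-mono s≤f G-covered)) ⟩
      8 * (2 * edgeCount H)      ≡⟨ *-assoc 8 2 (edgeCount H) ⟨
      16 * edgeCount H           ∎)
    where
    open CubeParameters P
    open ≤-Reasoning
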